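{- Let $a,c\in\mathbb{Z}$ be odd and let $f(n)=an^{2}+2an+c$. Suppose $4a^{2}-4ac=4^{\ell}\Delta$ where $\ell$ is the largest positive integer with $4^{\ell}\mid 4a^2-4ac$, $\ell\geq 2$, and $\Delta\equiv m\pmod 8$ with $m\in\{2,3,5,6,7\}$. Then the 2-adic valuation tree of $f$ is finite with $\ell$ levels, and for each $1\le i<\ell$ the unique non-terminating node at level $i$ is the class $n\equiv 2^{i}-1\pmod{2^i}$. Furthermore, for $n\in\mathbb{N}$: \[ \nu_{2}(f(n))=\begin{cases} 0,& \text{if } n\equiv 0\pmod 2;\\ 2(i-1),& \text{if } n\equiv \sum_{k=0}^{i-2}2^{k}\pmod{2^{i}} \text{ with } 2\leq i<\ell;\\ 2(\ell-1),& \text{if } n\equiv \sum_{k=0}^{\ell-2}2^{k}\pmod{2^{\ell}} \text{ and } m\in\{2,6\};\\ 2\ell-1,& \text{if } n\equiv \sum_{k=0}^{\ell-2}2^{k}\pmod{2^{\ell}} \text{ and } m\in\{3,7\};\\ 2\ell,& \text{if } n\equiv \sum_{k=0}^{\ell-2}2^{k}\pmod{2^{\ell}} \text{ and } m=5;\\ 2\ell-1,& \text{if } n\equiv \sum_{k=0}^{\ell-1}2^{k}\pmod{2^{\ell}} \text{ and } m\in\{2,6\};\\ 2(\ell-1),& \text{if } n\equiv \sum_{k=0}^{\ell-1}2^{k}\pmod{2^{\ell}} \text{ and } m\in\{3,5,7\}. \end{cases} \]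
   Context: $\nu_2(x)$ denotes the 2-adic valuation of an integer $x$ (with $\nu_2(0)=+\infty$), $\mathbb{N}=\{0,1,2,\ldots\}$. The 2-adic valuation tree of $f$: a node at level $i\geq 0$ is a residue class $\{2^{i}q+r: q\in\mathbb{N}\}$ with $0\le r<2^i$; the root (level 0) is all of $\mathbb{N}$. A node is terminating if $\nu_2(f(n))$ is constant on its class, and non-terminating otherwise; each non-terminating node $\{2^iq+r\}$ has children $\{2^{i+1}q+r\}$ and $\{2^{i+1}q+2^i+r\}$ at level $i+1$. The tree is finite with $\ell$ levels if $\ell$ is the smallest positive integer such that for every $r\in\{0,\ldots,2^{\ell}-1\}$ the sequence $(\nu_2(f(2^{\ell}q+r)))_{q\ge 0}$ is constant. -}

module Defs where

open import Data.Nat as ℕ using (ℕ; zero; suc; _<_; _≤_)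
open import Data.Integer as ℤ using (ℤ; +_)
open import Data.Integer.Divisibility using (_∣_)
open import Data.List using (map; upTo)
open import Data.Nat.ListAction using (sum)
open import Data.Product using (_×_; ∃)
open import Relation.Nullary using (¬_)
open import Relation.Binary.PropositionalEquality using (_≡_)
open import Function.Bundles using (_⇔_)

quadF : ℤ → ℤ → ℕ → ℤ
quadF a c n = a ℤ.* (+ n) ℤ.* (+ n) ℤ.+ + 2 ℤ.* a ℤ.* (+ n) ℤ.+ c

-- ν₂(x) = k   (for k : ℕ); ν₂(0) = ∞ satisfies IsVal2 0 k for no k.
IsVal2 : ℤ → ℕ → Set
IsVal2 x k = (+ (2 ℕ.^ k) ∣ x) × ¬ (+ (2 ℕ.^ suc k) ∣ x)

SameVal2 : ℤ → ℤ → Set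
SameVal2 x y = ∀ k → IsVal2 x k ⇔ IsVal2 y k

InClass : ℕ → ℕ → ℕ → Set
InClass i r n = ∃ λ q → n ≡ 2 ℕ.^ i ℕ.* q ℕ.+ r

Terminating : (ℕ → ℤ) → ℕ → ℕ → Set
Terminating g i r = ∀ q q′ → SameVal2 (g (2 ℕ.^ i ℕ.* q ℕ.+ r)) (g (2 ℕ.^ i ℕ.* q′ ℕ.+ r))

data InTree (g : ℕ → ℤ) : ℕ → ℕ → Set where
  root  : InTree g 0 0
  left  : ∀ {i r} → InTree g i r → ¬ Terminating g i r → InTree g (suc i) r
  right : ∀ {i r} → InTree g i r → ¬ Terminating g i r → InTree g (suc i) (2 ℕ.^ i ℕ.+ r)

AllTerminatingAt : (ℕ → ℤ) → ℕ → Set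
AllTerminatingAt g ℓ = ∀ r → r < 2 ℕ.^ ℓ → Terminating g ℓ r

FiniteWithLevels : (ℕ → ℤ) → ℕ → Set
FiniteWithLevels g ℓ =
  (1 ≤ ℓ) × AllTerminatingAt g ℓ × (∀ ℓ′ → 1 ≤ ℓ′ → ℓ′ < ℓ → ¬ AllTerminatingAt g ℓ′)

sumPow2 : ℕ → ℕ
sumPow2 j = sum (map (2 ℕ.^_) (upTo j))

-- Since a is odd, ν₂(f(n)) = ν₂(a f(n)), and completing the square gives
-- a f(n) = (a(n+1))² − 4^(ℓ−1) Δ.  Write n + 1 = 2^j w with w odd.  For
-- j < ℓ − 1 the square dominates and ν₂ = 2j.  For j = ℓ − 1 one gets
-- 4^(ℓ−1)((aw)² − Δ), and (aw)² ≡ 1 (mod 8) makes ν₂ depend only on Δ mod 8;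
-- for j ≥ ℓ one gets 4^(ℓ−1)(4y − Δ), again decided by Δ mod 8.  So
-- ν₂(f(n)) is a function of min(ν₂(n+1), ℓ) which changes at every step
-- 0, 1, …, ℓ; this forces the tree to consist of the spine 2^i − 1 up to
-- level ℓ, where every node terminates.
module Submission where

open import Defs
open import Data.Nat as ℕ using (ℕ; zero; suc; _<_; _≤_; _^_; _∸_; z≤n; s≤s; s≤s⁻¹)
open import Data.Integer as ℤ using (ℤ; +_; _+_; _*_; _-_; -_)
open import Data.Integer.Divisibility using (_∣_)
open import Data.Product using (_×_; ∃; ∃₂; _,_; proj₁)
open import Data.Sum using (_⊎_; inj₁; inj₂)
open import Data.Empty using (⊥-elim)
open import Data.List using ([]; _∷_; _∷ʳ_; applyUpTo)
open import Data.Nat.ListAction using (sum)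
open import Function.Base using (_∘_)
open import Function.Bundles using (_⇔_; mk⇔; Equivalence)
open import Relation.Nullary using (¬_; yes; no)
open import Relation.Nullary.Decidable using (decidable-stable)
open import Relation.Binary.PropositionalEquality

import Data.Nat.Properties as ℕP
import Data.Nat.Divisibility as ℕD
import Data.Integer.Properties as ℤP
import Data.Integer.Divisibility.Signed as Signed
import Data.Integer.DivMod as ℤDM
import Data.Nat.Tactic.RingSolver as ℕRing
open import Data.Nat.Primality using (Prime; euclidsLemma; prime[2]; prime⇒nonZero)
open import Data.Nat.Induction using (<-rec)
open import Data.List.Properties using (applyUpTo-∷ʳ; map-applyUpTo)
open import Data.Nat.ListAction.Properties using (sum-++)
open import Data.Integer.Tactic.RingSolver using (solve-∀)

open ≡-Reasoning

IsOdd : ℤ → Set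
IsOdd x = ∃ λ t → x ≡ + 1 + + 2 * t

even⊎odd : ∀ x → (∃ λ t → x ≡ + 2 * t) ⊎ IsOdd x
even⊎odd x with x ℤDM.% + 2 | ℤDM.n%d<d x (+ 2) | ℤDM.a≡a%n+[a/n]*n x (+ 2)
... | 0           | _               | x≡ = inj₁ (x ℤDM./ + 2 , trans x≡ (even (x ℤDM./ + 2)))
  where
  even : ∀ q → + 0 + q * + 2 ≡ + 2 * q
  even = solve-∀
... | 1           | _               | x≡ = inj₂ (x ℤDM./ + 2 , trans x≡ (odd (x ℤDM./ + 2)))
  where
  odd : ∀ q → + 1 + q * + 2 ≡ + 1 + + 2 * q
  odd = solve-∀
... | suc (suc _) | s≤s (s≤s ())    | _

¬2∣⇒isOdd : ∀ {x} → ¬ (+ 2 ∣ x) → IsOdd x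
¬2∣⇒isOdd {x} 2∤x with even⊎odd x
... | inj₂ x-odd      = x-odd
... | inj₁ (t , x≡2t) =
  ⊥-elim (2∤x (Signed.∣⇒∣ᵤ (Signed.divides t (trans x≡2t (ℤP.*-comm (+ 2) t)))))

isOdd⇒¬2∣ : ∀ {x} → IsOdd x → ¬ (+ 2 ∣ x)
isOdd⇒¬2∣ (t , refl) 2∣x = 2≢1 (ℕD.∣1⇒≡1 (Signed.∣⇒∣ᵤ 2∣1))
  where
  2∣1 : + 2 Signed.∣ + 1
  2∣1 = Signed.∣m+n∣n⇒∣m (Signed.∣ᵤ⇒∣ 2∣x) (Signed.∣m⇒∣m*n t Signed.∣-refl)
  2≢1 : 2 ≢ 1
  2≢1 ()

isOdd-* : ∀ {x y} → IsOdd x → IsOdd y → IsOdd (x * y)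
isOdd-* (s , refl) (t , refl) = s + t + + 2 * s * t , expand s t
  where
  expand : ∀ s t → (+ 1 + + 2 * s) * (+ 1 + + 2 * t) ≡ + 1 + + 2 * (s + t + + 2 * s * t)
  expand = solve-∀

-- t (t + 1) is even, so (1 + 2t)² = 1 + 4 t (t + 1) is 1 modulo 8.
isOdd⇒square≡1+8* : ∀ {u} → IsOdd u → ∃ λ ρ → u * u ≡ + 1 + + 8 * ρ
isOdd⇒square≡1+8* (t , refl) with even⊎odd t
... | inj₁ (r , refl) = r + + 2 * r * r , square r
  where
  square : ∀ r → (+ 1 + + 2 * (+ 2 * r)) * (+ 1 + + 2 * (+ 2 * r)) ≡ + 1 + + 8 * (r + + 2 * r * r)
  square = solve-∀
... | inj₂ (r , refl) = + 1 + + 3 * r + + 2 * r * r , square r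
  where
  square : ∀ r → (+ 1 + + 2 * (+ 1 + + 2 * r)) * (+ 1 + + 2 * (+ 1 + + 2 * r))
                 ≡ + 1 + + 8 * (+ 1 + + 3 * r + + 2 * r * r)
  square = solve-∀

∣x-y⇒x≡y+* : ∀ {d x y} → + d ∣ x - y → ∃ λ s → x ≡ y + + d * s
∣x-y⇒x≡y+* {d} {x} {y} d∣x-y with Signed.∣ᵤ⇒∣ d∣x-y
... | Signed.divides s x-y≡ = s , (begin
  x               ≡⟨ regroup x y ⟩
  y + (x - y)     ≡⟨ cong (_+_ y) x-y≡ ⟩
  y + s * + d     ≡⟨ cong (_+_ y) (ℤP.*-comm s (+ d)) ⟩
  y + + d * s     ∎)
  where
  regroup : ∀ x y → x ≡ y + (x - y)
  regroup = solve-∀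

^-monoʳ-∣ : ∀ b {m n} → m ≤ n → b ^ m ℕD.∣ b ^ n
^-monoʳ-∣ b {m} m≤n with ℕP.m≤n⇒∃[o]m+o≡n m≤n
... | o , refl = subst (b ^ m ℕD.∣_) (sym (ℕP.^-distribˡ-+-* b m o)) (ℕD.m∣m*n (b ^ o))

p^k∣m*n⇒p^k∣n : ∀ {p} k {m n} → Prime p → ¬ p ℕD.∣ m → p ^ k ℕD.∣ m ℕ.* n → p ^ k ℕD.∣ n
p^k∣m*n⇒p^k∣n zero {n = n} _ _ _ = ℕD.1∣ n
p^k∣m*n⇒p^k∣n {p} (suc k) {m} {n} pp p∤m p^[1+k]∣mn
  with euclidsLemma m n pp (ℕD.∣-trans (ℕD.m∣m*n (p ^ k)) p^[1+k]∣mn)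
... | inj₁ p∣m                 = ⊥-elim (p∤m p∣m)
... | inj₂ (ℕD.divides y refl) =
  subst (p ^ suc k ℕD.∣_) (ℕP.*-comm p y) (ℕD.*-monoʳ-∣ p (p^k∣m*n⇒p^k∣n k pp p∤m p^k∣my))
  where
  instance _ = prime⇒nonZero pp
  shift : ∀ m y p → m ℕ.* (y ℕ.* p) ≡ p ℕ.* (m ℕ.* y)
  shift = ℕRing.solve-∀
  p^k∣my : p ^ k ℕD.∣ m ℕ.* y
  p^k∣my = ℕD.*-cancelˡ-∣ p (subst (p ^ suc k ℕD.∣_) (shift m y p) p^[1+k]∣mn)

isVal2-intro : ∀ k t {x} → x ≡ + (2 ^ k) * (+ 1 + + 2 * t) → IsVal2 x k
isVal2-intro k t refl =
    subst (2 ^ k ℕD.∣_) (sym ∣x∣≡) (ℕD.m∣m*n ℤ.∣ w ∣)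
  , λ 2^[1+k]∣x → isOdd⇒¬2∣ (t , refl)
      (ℕD.*-cancelˡ-∣ (2 ^ k) {{ℕP.m^n≢0 2 k}}
        (subst₂ ℕD._∣_ (ℕP.*-comm 2 (2 ^ k)) ∣x∣≡ 2^[1+k]∣x))
  where
  w = + 1 + + 2 * t
  ∣x∣≡ : ℤ.∣ + (2 ^ k) * w ∣ ≡ 2 ^ k ℕ.* ℤ.∣ w ∣
  ∣x∣≡ = ℤP.abs-* (+ (2 ^ k)) w

isVal2-2* : ∀ {x k} → IsVal2 x k → IsVal2 (+ 2 * x) (suc k)
isVal2-2* {x} {k} (2^k∣x , 2^[1+k]∤x) =
    subst (2 ^ suc k ℕD.∣_) (sym ∣2x∣≡) (ℕD.*-monoʳ-∣ 2 2^k∣x)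
  , λ 2^[2+k]∣2x → 2^[1+k]∤x (ℕD.*-cancelˡ-∣ 2 (subst (2 ^ suc (suc k) ℕD.∣_) ∣2x∣≡ 2^[2+k]∣2x))
  where
  ∣2x∣≡ : ℤ.∣ + 2 * x ∣ ≡ 2 ℕ.* ℤ.∣ x ∣
  ∣2x∣≡ = ℤP.abs-* (+ 2) x

isVal2-4* : ∀ {x k} → IsVal2 x k → IsVal2 (+ 4 * x) (2 ℕ.+ k)
isVal2-4* {x} {k} v = subst (λ y → IsVal2 y (2 ℕ.+ k)) (sym (ℤP.*-assoc (+ 2) (+ 2) x))
  (isVal2-2* {+ 2 * x} {suc k} (isVal2-2* {x} {k} v))

isVal2-*-odd⁻¹ : ∀ {u x k} → ¬ (+ 2 ∣ u) → IsVal2 (u * x) k → IsVal2 x k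
isVal2-*-odd⁻¹ {u} {x} {k} 2∤u (2^k∣ux , 2^[1+k]∤ux) =
    p^k∣m*n⇒p^k∣n k prime[2] 2∤u (subst (2 ^ k ℕD.∣_) (ℤP.abs-* u x) 2^k∣ux)
  , λ 2^[1+k]∣x →
      2^[1+k]∤ux (subst (2 ^ suc k ℕD.∣_) (sym (ℤP.abs-* u x)) (ℕD.∣n⇒∣m*n ℤ.∣ u ∣ 2^[1+k]∣x))

isVal2-maximal : ∀ {x j k} → + (2 ^ j) ∣ x → IsVal2 x k → j ≤ k
isVal2-maximal {j = j} {k} 2^j∣x (_ , 2^[1+k]∤x) with j ℕP.≤? k
... | yes j≤k = j≤k
... | no  j≰k = ⊥-elim (2^[1+k]∤x (ℕD.∣-trans (^-monoʳ-∣ 2 (ℕP.≰⇒> j≰k)) 2^j∣x))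

isVal2-unique : ∀ {x j k} → IsVal2 x j → IsVal2 x k → j ≡ k
isVal2-unique {x} {j} {k} vj vk =
  ℕP.≤-antisym (isVal2-maximal {x} {j} {k} (proj₁ vj) vk) (isVal2-maximal {x} {k} {j} (proj₁ vk) vj)

isVal2⇒sameVal2 : ∀ {x y k} → IsVal2 x k → IsVal2 y k → SameVal2 x y
isVal2⇒sameVal2 {x} {y} {k} vx vy k′ = mk⇔
  (λ vx′ → subst (IsVal2 y) (isVal2-unique {x} {k} {k′} vx vx′) vy)
  (λ vy′ → subst (IsVal2 x) (isVal2-unique {y} {k} {k′} vy vy′) vx)

even⊎oddℕ : ∀ n → (∃ λ t → n ≡ 2 ℕ.* t) ⊎ (∃ λ t → n ≡ suc (2 ℕ.* t))
even⊎oddℕ zero = inj₁ (0 , refl)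
even⊎oddℕ (suc n) with even⊎oddℕ n
... | inj₁ (t , refl) = inj₂ (t , refl)
... | inj₂ (t , refl) = inj₁ (suc t , cong suc (sym (ℕP.+-suc t (t ℕ.+ 0))))

suc≡2^*odd : ∀ n → ∃₂ λ j w → suc n ≡ 2 ^ j ℕ.* suc (2 ℕ.* w)
suc≡2^*odd = <-rec _ split
  where
  split : ∀ n → (∀ {m} → m < n → ∃₂ λ j w → suc m ≡ 2 ^ j ℕ.* suc (2 ℕ.* w)) →
          ∃₂ λ j w → suc n ≡ 2 ^ j ℕ.* suc (2 ℕ.* w)
  split n rec with even⊎oddℕ (suc n)
  ... | inj₂ (w , 1+n≡)     = 0 , w , trans 1+n≡ (sym (ℕP.*-identityˡ _))
  ... | inj₁ (suc h , 1+n≡)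
    with rec (subst (h <_) (sym (ℕP.suc-injective 1+n≡)) (ℕP.m<m+n h (s≤s z≤n)))
  ...   | j , w , 1+h≡ = suc j , w , (begin
    suc n                             ≡⟨ 1+n≡ ⟩
    2 ℕ.* suc h                       ≡⟨ cong (2 ℕ.*_) 1+h≡ ⟩
    2 ℕ.* (2 ^ j ℕ.* suc (2 ℕ.* w))   ≡⟨ ℕP.*-assoc 2 (2 ^ j) _ ⟨
    2 ^ suc j ℕ.* suc (2 ℕ.* w)       ∎)

suc[2^i∸1] : ∀ i → suc (2 ^ i ∸ 1) ≡ 2 ^ i
suc[2^i∸1] i = ℕP.m+[n∸m]≡n (ℕP.m^n>0 2 i)

2^i∸1<2^i : ∀ i → 2 ^ i ∸ 1 < 2 ^ i
2^i∸1<2^i i = ℕP.≤-reflexive (suc[2^i∸1] i)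

suc≡2^j*odd⇒j<i : ∀ {i j r w} → suc r ≡ 2 ^ j ℕ.* suc (2 ℕ.* w) →
                  r < 2 ^ i → r ≢ 2 ^ i ∸ 1 → j < i
suc≡2^j*odd⇒j<i {i} {j} {r} {w} 1+r≡ r<2^i r≢ = ℕP.≰⇒> λ i≤j →
  r≢ (cong (_∸ 1) (ℕP.≤-antisym r<2^i (2^i≤1+r i≤j)))
  where
  2^i≤1+r : i ≤ j → 2 ^ i ≤ suc r
  2^i≤1+r i≤j = ℕP.≤-trans (ℕP.^-monoʳ-≤ 2 i≤j)
    (ℕP.≤-trans (ℕP.m≤m*n (2 ^ j) (suc (2 ℕ.* w))) (ℕP.≤-reflexive (sym 1+r≡)))

suc-spine : ∀ i q → suc (2 ^ i ℕ.* q ℕ.+ (2 ^ i ∸ 1)) ≡ 2 ^ i ℕ.* suc q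
suc-spine i q = begin
  suc (2 ^ i ℕ.* q ℕ.+ (2 ^ i ∸ 1))  ≡⟨ ℕP.+-suc _ _ ⟨
  2 ^ i ℕ.* q ℕ.+ suc (2 ^ i ∸ 1)    ≡⟨ cong (2 ^ i ℕ.* q ℕ.+_) (suc[2^i∸1] i) ⟩
  2 ^ i ℕ.* q ℕ.+ 2 ^ i              ≡⟨ ℕP.+-comm _ (2 ^ i) ⟩
  2 ^ i ℕ.+ 2 ^ i ℕ.* q              ≡⟨ ℕP.*-suc (2 ^ i) q ⟨
  2 ^ i ℕ.* suc q                    ∎

suc-spine-odd : ∀ j q → suc (2 ^ suc j ℕ.* q ℕ.+ (2 ^ j ∸ 1)) ≡ 2 ^ j ℕ.* suc (2 ℕ.* q)
suc-spine-odd j q = begin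
  suc (2 ^ suc j ℕ.* q ℕ.+ (2 ^ j ∸ 1))  ≡⟨ ℕP.+-suc _ _ ⟨
  2 ^ suc j ℕ.* q ℕ.+ suc (2 ^ j ∸ 1)    ≡⟨ cong (2 ^ suc j ℕ.* q ℕ.+_) (suc[2^i∸1] j) ⟩
  2 ℕ.* 2 ^ j ℕ.* q ℕ.+ 2 ^ j            ≡⟨ factor (2 ^ j) q ⟩
  2 ^ j ℕ.* suc (2 ℕ.* q)                ∎
  where
  factor : ∀ X q → 2 ℕ.* X ℕ.* q ℕ.+ X ≡ X ℕ.* suc (2 ℕ.* q)
  factor = ℕRing.solve-∀

suc-sum-pow2 : ∀ j → suc (sum (applyUpTo (2 ^_) j)) ≡ 2 ^ j
suc-sum-pow2 zero    = refl
suc-sum-pow2 (suc j) = begin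
  suc (sum (applyUpTo (2 ^_) (suc j)))             ≡⟨ cong (suc ∘ sum) (applyUpTo-∷ʳ (2 ^_) j) ⟨
  suc (sum (applyUpTo (2 ^_) j ∷ʳ 2 ^ j))          ≡⟨ cong suc (sum-++ (applyUpTo (2 ^_) j) (2 ^ j ∷ [])) ⟩
  suc (sum (applyUpTo (2 ^_) j) ℕ.+ (2 ^ j ℕ.+ 0)) ≡⟨ cong (ℕ._+ (2 ^ j ℕ.+ 0)) (suc-sum-pow2 j) ⟩
  2 ^ suc j                                        ∎

sumPow2≡2^∸1 : ∀ j → sumPow2 j ≡ 2 ^ j ∸ 1
sumPow2≡2^∸1 j = cong (_∸ 1) (trans (cong (suc ∘ sum) (map-applyUpTo (λ i → i) (2 ^_) j)) (suc-sum-pow2 j))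

module ValuationTree (f : ℕ → ℤ) (L : ℕ) (V : ℕ → ℕ)
  (valuation : ∀ n j w → suc n ≡ 2 ^ j ℕ.* suc (2 ℕ.* w) → IsVal2 (f n) (V j))
  (stable : ∀ d → V (suc L ℕ.+ d) ≡ V (suc L)) where

  valuation-top : ∀ n q → suc n ≡ 2 ^ suc L ℕ.* suc q → IsVal2 (f n) (V (suc L))
  valuation-top n q 1+n≡ with suc≡2^*odd q
  ... | d , w , 1+q≡ = subst (IsVal2 (f n)) (stable d) (valuation n (suc L ℕ.+ d) w (begin
    suc n
      ≡⟨ 1+n≡ ⟩
    2 ^ suc L ℕ.* suc q
      ≡⟨ cong (2 ^ suc L ℕ.*_) 1+q≡ ⟩
    2 ^ suc L ℕ.* (2 ^ d ℕ.* suc (2 ℕ.* w))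
      ≡⟨ ℕP.*-assoc (2 ^ suc L) (2 ^ d) _ ⟨
    2 ^ suc L ℕ.* 2 ^ d ℕ.* suc (2 ℕ.* w)
      ≡⟨ cong (ℕ._* suc (2 ℕ.* w)) (ℕP.^-distribˡ-+-* 2 (suc L) d) ⟨
    2 ^ (suc L ℕ.+ d) ℕ.* suc (2 ℕ.* w)
      ∎))

  terminating-of-constant : ∀ {i r} k → (∀ q → IsVal2 (f (2 ^ i ℕ.* q ℕ.+ r)) k) → Terminating f i r
  terminating-of-constant {i} {r} k const q q′ =
    isVal2⇒sameVal2 {f (2 ^ i ℕ.* q ℕ.+ r)} {f (2 ^ i ℕ.* q′ ℕ.+ r)} {k} (const q) (const q′)

  -- If n ≡ r (mod 2^i) with r ≠ 2^i − 1, then ν₂(n + 1) = ν₂(r + 1) < i.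
  terminating-off-spine : ∀ i r → r < 2 ^ i → r ≢ 2 ^ i ∸ 1 → Terminating f i r
  terminating-off-spine i r r<2^i r≢ with suc≡2^*odd r
  ... | j , w , 1+r≡ with ℕP.m≤n⇒∃[o]m+o≡n (suc≡2^j*odd⇒j<i {i} {j} {r} {w} 1+r≡ r<2^i r≢)
  ... | d , refl = terminating-of-constant {suc j ℕ.+ d} {r} (V j) λ q →
    valuation _ j (2 ^ d ℕ.* q ℕ.+ w) (begin
      suc (2 ^ (suc j ℕ.+ d) ℕ.* q ℕ.+ r)
        ≡⟨ ℕP.+-suc _ r ⟨
      2 ^ (suc j ℕ.+ d) ℕ.* q ℕ.+ suc r
        ≡⟨ cong₂ (λ x y → x ℕ.* q ℕ.+ y) (ℕP.^-distribˡ-+-* 2 (suc j) d) 1+r≡ ⟩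
      2 ℕ.* 2 ^ j ℕ.* 2 ^ d ℕ.* q ℕ.+ 2 ^ j ℕ.* suc (2 ℕ.* w)
        ≡⟨ factor (2 ^ j) (2 ^ d) q w ⟩
      2 ^ j ℕ.* suc (2 ℕ.* (2 ^ d ℕ.* q ℕ.+ w))
        ∎)
    where
    factor : ∀ X Y q w → 2 ℕ.* X ℕ.* Y ℕ.* q ℕ.+ X ℕ.* suc (2 ℕ.* w)
                       ≡ X ℕ.* suc (2 ℕ.* (Y ℕ.* q ℕ.+ w))
    factor = ℕRing.solve-∀

  allTerminatingAt : AllTerminatingAt f (suc L)
  allTerminatingAt r r<2^ℓ with r ℕP.≟ 2 ^ suc L ∸ 1
  ... | yes refl =
    terminating-of-constant {suc L} (V (suc L)) λ q → valuation-top _ q (suc-spine (suc L) q)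
  ... | no  r≢   = terminating-off-spine (suc L) r r<2^ℓ r≢

  module _ (jump : ∀ k → k ≤ L → V k ≢ V (suc k)) where

    spine-nonTerminating : ∀ k → k ≤ L → ¬ Terminating f k (2 ^ k ∸ 1)
    spine-nonTerminating k k≤L T =
      jump k k≤L (isVal2-unique {f n₁} {V k} (Equivalence.to (T 0 1 (V k)) v₀) v₁)
      where
      n₁ = 2 ^ k ℕ.* 1 ℕ.+ (2 ^ k ∸ 1)
      v₀ : IsVal2 (f (2 ^ k ℕ.* 0 ℕ.+ (2 ^ k ∸ 1))) (V k)
      v₀ = valuation _ k 0 (suc-spine k 0)
      double : ∀ X → X ℕ.* 2 ≡ 2 ℕ.* X ℕ.* 1
      double = ℕRing.solve-∀
      v₁ : IsVal2 (f n₁) (V (suc k))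
      v₁ = valuation _ (suc k) 0 (trans (suc-spine k 1) (double (2 ^ k)))

    spine-inTree : ∀ i → i ≤ L → InTree f i (2 ^ i ∸ 1)
    spine-inTree zero    _     = root
    spine-inTree (suc i) i<L =
      subst (InTree f (suc i)) right-child (right (spine-inTree i i≤L) (spine-nonTerminating i i≤L))
      where
      i≤L = ℕP.<⇒≤ i<L
      right-child : 2 ^ i ℕ.+ (2 ^ i ∸ 1) ≡ 2 ^ suc i ∸ 1
      right-child = cong (_∸ 1) (begin
        suc (2 ^ i ℕ.+ (2 ^ i ∸ 1))  ≡⟨ ℕP.+-suc (2 ^ i) _ ⟨
        2 ^ i ℕ.+ suc (2 ^ i ∸ 1)    ≡⟨ cong (2 ^ i ℕ.+_) (suc[2^i∸1] i) ⟩
        2 ^ i ℕ.+ 2 ^ i              ≡⟨ cong (2 ^ i ℕ.+_) (ℕP.+-identityʳ (2 ^ i)) ⟨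
        2 ^ suc i                    ∎)

    finiteWithLevels : FiniteWithLevels f (suc L)
    finiteWithLevels = s≤s z≤n , allTerminatingAt , λ ℓ′ _ ℓ′<ℓ all →
      spine-nonTerminating ℓ′ (s≤s⁻¹ ℓ′<ℓ) (all _ (2^i∸1<2^i ℓ′))

    spine-iff : ∀ i → i ≤ L → ∀ r → r < 2 ^ i →
                (InTree f i r × ¬ Terminating f i r) ⇔ (r ≡ 2 ^ i ∸ 1)
    spine-iff i i≤L r r<2^i = mk⇔
      (λ (_ , ¬T) → decidable-stable (r ℕP.≟ _) (¬T ∘ terminating-off-spine i r r<2^i))
      (λ { refl → spine-inTree i i≤L , spine-nonTerminating i i≤L })

module Profile (midE highE : ℕ) where

  -- profile L j is the valuation attached to ν₂(n + 1) = j: it is 2j for j < L,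
  -- 2L + midE for j = L and 2L + highE for j > L.
  profile : ℕ → ℕ → ℕ
  profile zero    zero    = midE
  profile zero    (suc _) = highE
  profile (suc L) zero    = 0
  profile (suc L) (suc j) = 2 ℕ.+ profile L j

  profile-below : ∀ {L j} → j < L → profile L j ≡ 2 ℕ.* j
  profile-below {suc L} {zero}  _         = refl
  profile-below {suc L} {suc j} (s≤s j<L) = trans (cong (2 ℕ.+_) (profile-below j<L)) (sym (ℕP.*-suc 2 j))

  profile-at : ∀ L → profile L L ≡ 2 ℕ.* L ℕ.+ midE
  profile-at zero    = refl
  profile-at (suc L) = trans (cong (2 ℕ.+_) (profile-at L)) (cong (ℕ._+ midE) (sym (ℕP.*-suc 2 L)))

  profile-top : ∀ L → profile L (suc L) ≡ 2 ℕ.* L ℕ.+ highE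
  profile-top zero    = refl
  profile-top (suc L) = trans (cong (2 ℕ.+_) (profile-top L)) (cong (ℕ._+ highE) (sym (ℕP.*-suc 2 L)))

  profile-stable : ∀ L d → profile L (suc L ℕ.+ d) ≡ profile L (suc L)
  profile-stable zero    d = refl
  profile-stable (suc L) d = cong (2 ℕ.+_) (profile-stable L d)

  profile-jump : midE ≢ highE → ∀ L k → k ≤ L → profile L k ≢ profile L (suc k)
  profile-jump mid≢high zero    zero    _         = mid≢high
  profile-jump mid≢high (suc L) zero    _         = λ ()
  profile-jump mid≢high (suc L) (suc k) (s≤s k≤L) =
    profile-jump mid≢high L k k≤L ∘ ℕP.suc-injective ∘ ℕP.suc-injective

MidResidue : ℤ → ℕ → Set
MidResidue Δ k = ∀ u → IsOdd u → IsVal2 (u * u - Δ) k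

TopResidue : ℤ → ℕ → Set
TopResidue Δ k = ∀ y → IsVal2 (+ 4 * y - Δ) k

record Residues (Δ : ℤ) (midE highE : ℕ) : Set where
  constructor _,_
  field
    mid : MidResidue Δ midE
    top : TopResidue Δ highE

mod8⇒midResidue : ∀ {Δ} m k → + 8 ∣ Δ - + m →
                  (∀ y → IsVal2 (+ 1 - + m + + 8 * y) k) → MidResidue Δ k
mod8⇒midResidue {Δ} m k 8∣Δ-m val u u-odd
  with ∣x-y⇒x≡y+* {x = Δ} {+ m} 8∣Δ-m | isOdd⇒square≡1+8* u-odd
... | s , refl | ρ , u²≡ = subst (λ z → IsVal2 z k) (sym (begin
  u * u - (+ m + + 8 * s)                  ≡⟨ cong (_- (+ m + + 8 * s)) u²≡ ⟩
  + 1 + + 8 * ρ - (+ m + + 8 * s)          ≡⟨ regroup (+ m) ρ s ⟩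
  + 1 - + m + + 8 * (ρ - s)                ∎)) (val (ρ - s))
  where
  regroup : ∀ M ρ s → + 1 + + 8 * ρ - (M + + 8 * s) ≡ + 1 - M + + 8 * (ρ - s)
  regroup = solve-∀

mod8⇒topResidue : ∀ {Δ} m k → + 8 ∣ Δ - + m →
                  (∀ y → IsVal2 (- + m + + 4 * y) k) → TopResidue Δ k
mod8⇒topResidue {Δ} m k 8∣Δ-m val y with ∣x-y⇒x≡y+* {x = Δ} {+ m} 8∣Δ-m
... | s , refl = subst (λ z → IsVal2 z k) (sym (regroup (+ m) y s)) (val (y - + 2 * s))
  where
  regroup : ∀ M y s → + 4 * y - (M + + 8 * s) ≡ - M + + 4 * (y - + 2 * s)
  regroup = solve-∀

residues₂₆ : ∀ {Δ m} → + 8 ∣ Δ - + m → m ≡ 2 ⊎ m ≡ 6 → Residues Δ 0 1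
residues₂₆ {Δ} 8∣ (inj₁ refl) =
    mod8⇒midResidue {Δ} 2 0 8∣ (λ y → isVal2-intro 0 (+ 4 * y - + 1) (mid y))
  , mod8⇒topResidue {Δ} 2 1 8∣ (λ y → isVal2-intro 1 (y - + 1) (top y))
  where
  mid : ∀ y → + 1 - + 2 + + 8 * y ≡ + 1 * (+ 1 + + 2 * (+ 4 * y - + 1))
  mid = solve-∀
  top : ∀ y → - + 2 + + 4 * y ≡ + 2 * (+ 1 + + 2 * (y - + 1))
  top = solve-∀
residues₂₆ {Δ} 8∣ (inj₂ refl) =
    mod8⇒midResidue {Δ} 6 0 8∣ (λ y → isVal2-intro 0 (+ 4 * y - + 3) (mid y))
  , mod8⇒topResidue {Δ} 6 1 8∣ (λ y → isVal2-intro 1 (y - + 2) (top y))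
  where
  mid : ∀ y → + 1 - + 6 + + 8 * y ≡ + 1 * (+ 1 + + 2 * (+ 4 * y - + 3))
  mid = solve-∀
  top : ∀ y → - + 6 + + 4 * y ≡ + 2 * (+ 1 + + 2 * (y - + 2))
  top = solve-∀

residues₃₇ : ∀ {Δ m} → + 8 ∣ Δ - + m → m ≡ 3 ⊎ m ≡ 7 → Residues Δ 1 0
residues₃₇ {Δ} 8∣ (inj₁ refl) =
    mod8⇒midResidue {Δ} 3 1 8∣ (λ y → isVal2-intro 1 (+ 2 * y - + 1) (mid y))
  , mod8⇒topResidue {Δ} 3 0 8∣ (λ y → isVal2-intro 0 (+ 2 * y - + 2) (top y))
  where
  mid : ∀ y → + 1 - + 3 + + 8 * y ≡ + 2 * (+ 1 + + 2 * (+ 2 * y - + 1))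
  mid = solve-∀
  top : ∀ y → - + 3 + + 4 * y ≡ + 1 * (+ 1 + + 2 * (+ 2 * y - + 2))
  top = solve-∀
residues₃₇ {Δ} 8∣ (inj₂ refl) =
    mod8⇒midResidue {Δ} 7 1 8∣ (λ y → isVal2-intro 1 (+ 2 * y - + 2) (mid y))
  , mod8⇒topResidue {Δ} 7 0 8∣ (λ y → isVal2-intro 0 (+ 2 * y - + 4) (top y))
  where
  mid : ∀ y → + 1 - + 7 + + 8 * y ≡ + 2 * (+ 1 + + 2 * (+ 2 * y - + 2))
  mid = solve-∀
  top : ∀ y → - + 7 + + 4 * y ≡ + 1 * (+ 1 + + 2 * (+ 2 * y - + 4))
  top = solve-∀

residues₅ : ∀ {Δ m} → + 8 ∣ Δ - + m → m ≡ 5 → Residues Δ 2 0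
residues₅ {Δ} 8∣ refl =
    mod8⇒midResidue {Δ} 5 2 8∣ (λ y → isVal2-intro 2 (y - + 1) (mid y))
  , mod8⇒topResidue {Δ} 5 0 8∣ (λ y → isVal2-intro 0 (+ 2 * y - + 3) (top y))
  where
  mid : ∀ y → + 1 - + 5 + + 8 * y ≡ + 4 * (+ 1 + + 2 * (y - + 1))
  mid = solve-∀
  top : ∀ y → - + 5 + + 4 * y ≡ + 1 * (+ 1 + + 2 * (+ 2 * y - + 3))
  top = solve-∀

residues₃₅₇ : ∀ {Δ m} → + 8 ∣ Δ - + m → m ≡ 3 ⊎ m ≡ 5 ⊎ m ≡ 7 →
              ∃ λ midE → Residues Δ midE 0
residues₃₅₇ {Δ} 8∣ (inj₁ e)        = 1 , residues₃₇ {Δ} 8∣ (inj₁ e)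
residues₃₅₇ {Δ} 8∣ (inj₂ (inj₁ e)) = 2 , residues₅ {Δ} 8∣ e
residues₃₅₇ {Δ} 8∣ (inj₂ (inj₂ e)) = 1 , residues₃₇ {Δ} 8∣ (inj₂ e)

residues : ∀ {Δ m} → + 8 ∣ Δ - + m → (m ≡ 2 ⊎ m ≡ 3 ⊎ m ≡ 5 ⊎ m ≡ 6 ⊎ m ≡ 7) →
           ∃₂ λ midE highE → midE ≢ highE × Residues Δ midE highE
residues {Δ} 8∣ (inj₁ e)                      = 0 , 1 , (λ ()) , residues₂₆ {Δ} 8∣ (inj₁ e)
residues {Δ} 8∣ (inj₂ (inj₁ e))               = 1 , 0 , (λ ()) , residues₃₇ {Δ} 8∣ (inj₁ e)
residues {Δ} 8∣ (inj₂ (inj₂ (inj₁ e)))        = 2 , 0 , (λ ()) , residues₅ {Δ} 8∣ e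
residues {Δ} 8∣ (inj₂ (inj₂ (inj₂ (inj₁ e)))) = 0 , 1 , (λ ()) , residues₂₆ {Δ} 8∣ (inj₂ e)
residues {Δ} 8∣ (inj₂ (inj₂ (inj₂ (inj₂ e)))) = 1 , 0 , (λ ()) , residues₃₇ {Δ} 8∣ (inj₂ e)

completedSquare : ℤ → ℤ → ℕ → ℤ → ℤ
completedSquare a Δ L x = a * x * (a * x) - + (4 ^ L) * Δ

a*quadF≡completedSquare : ∀ a c Δ L → + 4 * a * a - + 4 * a * c ≡ + (4 ^ suc L) * Δ →
                          ∀ n → a * quadF a c n ≡ completedSquare a Δ L (+ suc n)
a*quadF≡completedSquare a c Δ L disc n = begin
  a * quadF a c n
    ≡⟨ complete a c (+ n) ⟩
  a * (+ 1 + + n) * (a * (+ 1 + + n)) - (a * a - a * c)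
    ≡⟨ cong₂ (λ x D → a * x * (a * x) - D) (sym (ℤP.pos-+ 1 n)) a²-ac≡ ⟩
  completedSquare a Δ L (+ suc n)
    ∎
  where
  complete : ∀ a c x → a * (a * x * x + + 2 * a * x + c)
                     ≡ a * (+ 1 + x) * (a * (+ 1 + x)) - (a * a - a * c)
  complete = solve-∀
  times4 : ∀ a c → + 4 * (a * a - a * c) ≡ + 4 * a * a - + 4 * a * c
  times4 = solve-∀
  a²-ac≡ : a * a - a * c ≡ + (4 ^ L) * Δ
  a²-ac≡ = ℤP.*-cancelˡ-≡ (+ 4) _ _ (begin
    + 4 * (a * a - a * c)       ≡⟨ times4 a c ⟩
    + 4 * a * a - + 4 * a * c   ≡⟨ disc ⟩
    + (4 ^ suc L) * Δ           ≡⟨ cong (_* Δ) (ℤP.pos-* 4 (4 ^ L)) ⟩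
    + 4 * + (4 ^ L) * Δ         ≡⟨ ℤP.*-assoc (+ 4) (+ (4 ^ L)) Δ ⟩
    + 4 * (+ (4 ^ L) * Δ)       ∎)

completedSquare-suc : ∀ a Δ L x →
                      completedSquare a Δ (suc L) x ≡ a * x * (a * x) - + 4 * (+ (4 ^ L) * Δ)
completedSquare-suc a Δ L x = cong (_-_ (a * x * (a * x)))
  (trans (cong (_* Δ) (ℤP.pos-* 4 (4 ^ L))) (ℤP.*-assoc (+ 4) (+ (4 ^ L)) Δ))

completedSquare-double : ∀ a Δ L x →
                         completedSquare a Δ (suc L) (+ 2 * x) ≡ + 4 * completedSquare a Δ L x
completedSquare-double a Δ L x =
  trans (completedSquare-suc a Δ L (+ 2 * x)) (factor a x (+ (4 ^ L) * Δ))
  where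
  factor : ∀ a x Q → a * (+ 2 * x) * (a * (+ 2 * x)) - + 4 * Q ≡ + 4 * (a * x * (a * x) - Q)
  factor = solve-∀

isVal2-odd²-4* : ∀ {u} → IsOdd u → ∀ y → IsVal2 (u * u - + 4 * y) 0
isVal2-odd²-4* (t , refl) y = isVal2-intro 0 (+ 2 * t + + 2 * t * t - + 2 * y) (expand t y)
  where
  expand : ∀ t y → (+ 1 + + 2 * t) * (+ 1 + + 2 * t) - + 4 * y
                  ≡ + 1 * (+ 1 + + 2 * (+ 2 * t + + 2 * t * t - + 2 * y))
  expand = solve-∀

+2^[1+j]*≡ : ∀ j w → + (2 ^ suc j) * w ≡ + 2 * (+ (2 ^ j) * w)
+2^[1+j]*≡ j w = trans (cong (_* w) (ℤP.pos-* 2 (2 ^ j))) (ℤP.*-assoc (+ 2) (+ (2 ^ j)) w)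

module _ {midE highE : ℕ} where
  open Profile midE highE

  -- Induction on (L, j) along completedSquare (L + 1) (2x) = 4 · completedSquare L x.
  completedSquare-valuation : ∀ {a Δ} → IsOdd a → Residues Δ midE highE →
    ∀ L j {w} → IsOdd w → IsVal2 (completedSquare a Δ L (+ (2 ^ j) * w)) (profile L j)
  completedSquare-valuation {a} {Δ} a-odd (mid , _) zero zero {w} w-odd =
    subst (λ z → IsVal2 z midE) (sym (begin
      completedSquare a Δ 0 (+ 1 * w)  ≡⟨ cong (completedSquare a Δ 0) (ℤP.*-identityˡ w) ⟩
      a * w * (a * w) - + 1 * Δ        ≡⟨ cong (_-_ (a * w * (a * w))) (ℤP.*-identityˡ Δ) ⟩
      a * w * (a * w) - Δ              ∎)) (mid (a * w) (isOdd-* a-odd w-odd))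
  completedSquare-valuation {a} {Δ} a-odd (_ , top) zero (suc j) {w} _ =
    subst (λ z → IsVal2 z highE) (sym (begin
      completedSquare a Δ 0 (+ (2 ^ suc j) * w)   ≡⟨ cong (completedSquare a Δ 0) (+2^[1+j]*≡ j w) ⟩
      completedSquare a Δ 0 (+ 2 * X)             ≡⟨ factor a X Δ ⟩
      + 4 * (a * X * (a * X)) - Δ                 ∎)) (top (a * X * (a * X)))
    where
    X = + (2 ^ j) * w
    factor : ∀ a X Δ → a * (+ 2 * X) * (a * (+ 2 * X)) - + 1 * Δ ≡ + 4 * (a * X * (a * X)) - Δ
    factor = solve-∀
  completedSquare-valuation {a} {Δ} a-odd _ (suc L) zero {w} w-odd =
    subst (λ z → IsVal2 z 0) (sym (begin
      completedSquare a Δ (suc L) (+ 1 * w)    ≡⟨ cong (completedSquare a Δ (suc L)) (ℤP.*-identityˡ w) ⟩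
      completedSquare a Δ (suc L) w            ≡⟨ completedSquare-suc a Δ L w ⟩
      a * w * (a * w) - + 4 * (+ (4 ^ L) * Δ)  ∎))
    (isVal2-odd²-4* (isOdd-* a-odd w-odd) (+ (4 ^ L) * Δ))
  completedSquare-valuation {a} {Δ} a-odd res (suc L) (suc j) {w} w-odd =
    subst (λ z → IsVal2 z (2 ℕ.+ profile L j)) (sym (begin
      completedSquare a Δ (suc L) (+ (2 ^ suc j) * w)
        ≡⟨ cong (completedSquare a Δ (suc L)) (+2^[1+j]*≡ j w) ⟩
      completedSquare a Δ (suc L) (+ 2 * X)
        ≡⟨ completedSquare-double a Δ L X ⟩
      + 4 * completedSquare a Δ L X
        ∎))
    (isVal2-4* {completedSquare a Δ L X} {profile L j} (completedSquare-valuation a-odd res L j w-odd))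
    where
    X = + (2 ^ j) * w

module QuadraticTree (a c Δ : ℤ) (L : ℕ) (a-odd : ¬ (+ 2 ∣ a))
  (disc : + 4 * a * a - + 4 * a * c ≡ + (4 ^ suc L) * Δ)
  {midE highE : ℕ} (res : Residues Δ midE highE) where

  open Profile midE highE

  valuation : ∀ n j w → suc n ≡ 2 ^ j ℕ.* suc (2 ℕ.* w) → IsVal2 (quadF a c n) (profile L j)
  valuation n j w 1+n≡ = isVal2-*-odd⁻¹ {a} {quadF a c n} {profile L j} a-odd
    (subst (λ z → IsVal2 z (profile L j)) (sym a*f≡)
      (completedSquare-valuation {a = a} {Δ} (¬2∣⇒isOdd {a} a-odd) res L j (+ w , odd)))
    where
    odd : + suc (2 ℕ.* w) ≡ + 1 + + 2 * + w
    odd = trans (ℤP.pos-+ 1 (2 ℕ.* w)) (cong (_+_ (+ 1)) (ℤP.pos-* 2 w))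
    a*f≡ : a * quadF a c n ≡ completedSquare a Δ L (+ (2 ^ j) * + suc (2 ℕ.* w))
    a*f≡ = begin
      a * quadF a c n                        ≡⟨ a*quadF≡completedSquare a c Δ L disc n ⟩
      completedSquare a Δ L (+ suc n)        ≡⟨ cong (completedSquare a Δ L ∘ +_) 1+n≡ ⟩
      completedSquare a Δ L (+ (2 ^ j ℕ.* suc (2 ℕ.* w)))
        ≡⟨ cong (completedSquare a Δ L) (ℤP.pos-* (2 ^ j) (suc (2 ℕ.* w))) ⟩
      completedSquare a Δ L (+ (2 ^ j) * + suc (2 ℕ.* w))  ∎

  open ValuationTree (quadF a c) L (profile L) valuation (profile-stable L) public

  spine-jump : midE ≢ highE → ∀ k → k ≤ L → profile L k ≢ profile L (suc k)
  spine-jump mid≢high = profile-jump mid≢high L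

  valuation-spineClass : ∀ j n → InClass (suc j) (sumPow2 j) n → IsVal2 (quadF a c n) (profile L j)
  valuation-spineClass j _ (q , refl) = valuation _ j q
    (trans (cong (λ r → suc (2 ^ suc j ℕ.* q ℕ.+ r)) (sumPow2≡2^∸1 j)) (suc-spine-odd j q))

  valuation-midClass : ∀ n → InClass (suc L) (sumPow2 L) n →
                       IsVal2 (quadF a c n) (2 ℕ.* L ℕ.+ midE)
  valuation-midClass n cls = subst (IsVal2 (quadF a c n)) (profile-at L) (valuation-spineClass L n cls)

  valuation-topClass : ∀ n → InClass (suc L) (sumPow2 (suc L)) n →
                       IsVal2 (quadF a c n) (2 ℕ.* L ℕ.+ highE)
  valuation-topClass n (q , refl) = subst (IsVal2 (quadF a c n)) (profile-top L) (valuation-top _ q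
    (trans (cong (λ r → suc (2 ^ suc L ℕ.* q ℕ.+ r)) (sumPow2≡2^∸1 (suc L))) (suc-spine (suc L) q)))

2*[1+n]∸1≡2*n+1 : ∀ n → 2 ℕ.* suc n ∸ 1 ≡ 2 ℕ.* n ℕ.+ 1
2*[1+n]∸1≡2*n+1 n = trans (cong (_∸ 1) (ℕP.*-suc 2 n)) (ℕP.+-comm 1 (2 ℕ.* n))

2*[1+n]≡2*n+2 : ∀ n → 2 ℕ.* suc n ≡ 2 ℕ.* n ℕ.+ 2
2*[1+n]≡2*n+2 n = trans (ℕP.*-suc 2 n) (ℕP.+-comm 2 (2 ℕ.* n))

proposition23 : (a c Δ : ℤ) (ℓ m : ℕ) →
    ¬ (+ 2 ∣ a) → ¬ (+ 2 ∣ c) →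
    + 4 ℤ.* a ℤ.* a ℤ.- + 4 ℤ.* a ℤ.* c ≡ + (4 ℕ.^ ℓ) ℤ.* Δ →
    (∀ ℓ′ → ℓ < ℓ′ → ¬ (+ (4 ℕ.^ ℓ′) ∣ (+ 4 ℤ.* a ℤ.* a ℤ.- + 4 ℤ.* a ℤ.* c))) →
    2 ≤ ℓ →
    (m ≡ 2 ⊎ m ≡ 3 ⊎ m ≡ 5 ⊎ m ≡ 6 ⊎ m ≡ 7) →
    + 8 ∣ (Δ ℤ.- + m) →
    FiniteWithLevels (quadF a c) ℓ
    × (∀ i → 1 ≤ i → i < ℓ → ∀ r → r < 2 ℕ.^ i →
         (InTree (quadF a c) i r × ¬ Terminating (quadF a c) i r) ⇔ (r ≡ 2 ℕ.^ i ℕ.∸ 1))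
    × (∀ n →
         (InClass 1 0 n → IsVal2 (quadF a c n) 0)
       × (∀ i → 2 ≤ i → i < ℓ → InClass i (sumPow2 (i ℕ.∸ 1)) n →
            IsVal2 (quadF a c n) (2 ℕ.* (i ℕ.∸ 1)))
       × (InClass ℓ (sumPow2 (ℓ ℕ.∸ 1)) n → (m ≡ 2 ⊎ m ≡ 6) →
            IsVal2 (quadF a c n) (2 ℕ.* (ℓ ℕ.∸ 1)))
       × (InClass ℓ (sumPow2 (ℓ ℕ.∸ 1)) n → (m ≡ 3 ⊎ m ≡ 7) →
            IsVal2 (quadF a c n) (2 ℕ.* ℓ ℕ.∸ 1))
       × (InClass ℓ (sumPow2 (ℓ ℕ.∸ 1)) n → m ≡ 5 →
            IsVal2 (quadF a c n) (2 ℕ.* ℓ))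
       × (InClass ℓ (sumPow2 ℓ) n → (m ≡ 2 ⊎ m ≡ 6) →
            IsVal2 (quadF a c n) (2 ℕ.* ℓ ℕ.∸ 1))
       × (InClass ℓ (sumPow2 ℓ) n → (m ≡ 3 ⊎ m ≡ 5 ⊎ m ≡ 7) →
            IsVal2 (quadF a c n) (2 ℕ.* (ℓ ℕ.∸ 1))))
proposition23 a c Δ (suc (suc k)) m a-odd _ disc _ (s≤s (s≤s z≤n)) m-cases 8∣Δ-m =
  let (_ , _ , mid≢high , res) = residues {Δ} 8∣Δ-m m-cases in
    finiteWithLevels res (spine-jump res mid≢high)
  , (λ i _ i<ℓ → spine-iff res (spine-jump res mid≢high) i (s≤s⁻¹ i<ℓ))
  , λ n →
      valuation-spineClass res 0 n
    , (λ { (suc j) _ j<ℓ cls →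
           subst (Val n) (Profile.profile-below _ _ (s≤s⁻¹ j<ℓ)) (valuation-spineClass res j n cls) })
    , (λ cls e → subst (Val n) (ℕP.+-identityʳ (2 ℕ.* L))
                   (valuation-midClass (residues₂₆ {Δ} 8∣Δ-m e) n cls))
    , (λ cls e → subst (Val n) (sym (2*[1+n]∸1≡2*n+1 L))
                   (valuation-midClass (residues₃₇ {Δ} 8∣Δ-m e) n cls))
    , (λ cls e → subst (Val n) (sym (2*[1+n]≡2*n+2 L))
                   (valuation-midClass (residues₅ {Δ} 8∣Δ-m e) n cls))
    , (λ cls e → subst (Val n) (sym (2*[1+n]∸1≡2*n+1 L))
                   (valuation-topClass (residues₂₆ {Δ} 8∣Δ-m e) n cls))
    , (λ cls e → let (_ , res₀) = residues₃₅₇ {Δ} 8∣Δ-m e in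
                 subst (Val n) (ℕP.+-identityʳ (2 ℕ.* L)) (valuation-topClass res₀ n cls))
  where
  L = suc k
  Val : ℕ → ℕ → Set
  Val n = IsVal2 (quadF a c n)
  open QuadraticTree a c Δ L a-odd disc
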